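{- Let $p \geq 2$ and $s_1, s_2 \geq 1$ be integers. Let $b_n = b_n^{(s_1)}$ ($n \geq -2$) be defined by $b_n = b_{n-1}+b_{n-2}$ for $n\ge 0$, $b_{ -2} = 2^{s_1}$, $b_{ -1} = 2^{s_1-1}(s_1+2)$. Define $$x(p) := \left(2s_1 + 2s_2 + \tfrac{1}{2}s_1 s_2 + 8\right)F_{2p-2} - (s_1+s_2+8)F_{2p-4} + 2F_{2p-6},$$ $$a(p) := 2^{1-s_1}\left(2 b_{2p-3} + s_2\, b_{2p-4}\right).$$ Then $x(p) = \dfrac{a(p)}{2}$.
   Context: $F_n$ denotes the Fibonacci numbers with $F_1 = F_2 = 1$, $F_n = F_{n-1} + F_{n-2}$, extended to all integers by the same recurrence, so $F_0 = 0$, $F_{ -1} = 1$, $F_{ -2} = -1$. -}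

module Defs where

open import Data.Nat as ℕ using (ℕ; zero; suc)
open import Data.Integer as ℤ using (ℤ; +_; -[1+_])
open import Data.Rational as ℚ using (ℚ; ½)

fibℕ : ℕ → ℤ
fibℕ zero = + 0
fibℕ (suc zero) = + 1
fibℕ (suc (suc n)) = fibℕ (suc n) ℤ.+ fibℕ n

-- fibNeg n = F_{-n}, obtained by running the recurrence backwards:
-- F_{-(n+2)} = F_{-n} - F_{-(n+1)}
fibNeg : ℕ → ℤ
fibNeg zero = + 0
fibNeg (suc zero) = + 1
fibNeg (suc (suc n)) = fibNeg n ℤ.- fibNeg (suc n)

fib : ℤ → ℤ
fib (+ n) = fibℕ n
fib -[1+ n ] = fibNeg (suc n)

-- bseq s k = b^{(s)}_{k-2}, i.e. the sequence b_n (n ≥ -2) shifted by 2: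
-- b_{-2} = 2^s, b_{-1} = 2^{s-1}(s+2), b_n = b_{n-1} + b_{n-2} (n ≥ 0)
bseq : ℕ → ℕ → ℤ
bseq s zero = + (2 ℕ.^ s)
bseq s (suc zero) = + (2 ℕ.^ (s ℕ.∸ 1) ℕ.* (s ℕ.+ 2))
bseq s (suc (suc k)) = bseq s (suc k) ℤ.+ bseq s k

-- b^{(s)}_n for integer n ≥ -2 (n given as an integer; only used with n ≥ -2)
b : ℕ → ℤ → ℤ
b s n = bseq s (ℤ.∣ n ℤ.+ + 2 ∣)

ℤtoℚ : ℤ → ℚ
ℤtoℚ z = z ℚ./ 1

ℕtoℚ : ℕ → ℚ
ℕtoℚ n = ℤtoℚ (+ n)

pow2inv : ℕ → ℚ
pow2inv zero = ℚ.1ℚ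
pow2inv (suc k) = ½ ℚ.* pow2inv k

2p- : ℕ → ℕ → ℤ
2p- p c = + (2 ℕ.* p) ℤ.- + c

x : ℕ → ℕ → ℕ → ℚ
x s₁ s₂ p =
  ((ℕtoℚ 2 ℚ.* ℕtoℚ s₁ ℚ.+ ℕtoℚ 2 ℚ.* ℕtoℚ s₂ ℚ.+ ½ ℚ.* ℕtoℚ s₁ ℚ.* ℕtoℚ s₂ ℚ.+ ℕtoℚ 8)
      ℚ.* ℤtoℚ (fib (2p- p 2)))
  ℚ.- ((ℕtoℚ s₁ ℚ.+ ℕtoℚ s₂ ℚ.+ ℕtoℚ 8) ℚ.* ℤtoℚ (fib (2p- p 4)))
  ℚ.+ ℕtoℚ 2 ℚ.* ℤtoℚ (fib (2p- p 6))

-- a(p) = 2^{1-s1} (2 b_{2p-3} + s2 b_{2p-4}),  with b = b^{(s1)}; here s1 ≥ 1 so 2^{1-s1} = 2^{-(s1-1)}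
a : ℕ → ℕ → ℕ → ℚ
a s₁ s₂ p =
  pow2inv (s₁ ℕ.∸ 1) ℚ.*
    (ℕtoℚ 2 ℚ.* ℤtoℚ (b s₁ (2p- p 3)) ℚ.+ ℕtoℚ s₂ ℚ.* ℤtoℚ (b s₁ (2p- p 4)))

-- The b-sequence satisfies the Fibonacci recurrence, so its closed form is
-- b^{(s)}_{n-2} = 2^{s-1} (s F_n + 2 F_{n+1}); the power of 2 cancels the factor 2^{1-s}
-- in a(p). Expressing every Fibonacci number in x(p) and a(p) through F_{2p-4} and
-- F_{2p-3}, using F_{n+2} = F_{n+1} + F_n (also backwards, for F_{2p-6}), leaves a
-- polynomial identity.

{-# OPTIONS --safe #-}
module Submission where

open import Defs
open import Data.Nat as ℕ using (ℕ; zero; suc; _≤_; s≤s)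
import Data.Nat.Properties as ℕP
open import Data.Integer as ℤ using (ℤ; +_; _⊖_)
import Data.Integer.Properties as ℤP
open import Data.Rational as ℚ using (ℚ; ½; 1ℚ; _+_; _*_; _-_)
import Data.Rational.Properties as ℚP
open import Data.Rational.Unnormalised as ℚᵘ using (mkℚᵘ)
import Data.Rational.Unnormalised.Properties as ℚᵘP
open import Data.Rational.Solver using (module +-*-Solver)
open import Function using (_∘_)
open import Relation.Binary.PropositionalEquality

ℤtoℚ-homo-+ : ∀ i j → ℤtoℚ (i ℤ.+ j) ≡ ℤtoℚ i + ℤtoℚ j
ℤtoℚ-homo-+ i j = ℚP.toℚᵘ-injective (begin
  ℚ.toℚᵘ (ℤtoℚ (i ℤ.+ j))              ≈⟨ toℚᵘ-ℤtoℚ (i ℤ.+ j) ⟩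
  mkℚᵘ (i ℤ.+ j) 0                      ≡⟨ cong (λ n → mkℚᵘ n 0) i*1+j*1≡i+j ⟨
  mkℚᵘ i 0 ℚᵘ.+ mkℚᵘ j 0                ≈⟨ ℚᵘP.+-cong (toℚᵘ-ℤtoℚ i) (toℚᵘ-ℤtoℚ j) ⟨
  ℚ.toℚᵘ (ℤtoℚ i) ℚᵘ.+ ℚ.toℚᵘ (ℤtoℚ j)  ≈⟨ ℚP.toℚᵘ-homo-+ (ℤtoℚ i) (ℤtoℚ j) ⟨
  ℚ.toℚᵘ (ℤtoℚ i + ℤtoℚ j)              ∎)
  where
  open ℚᵘP.≃-Reasoning
  toℚᵘ-ℤtoℚ : ∀ z → ℚ.toℚᵘ (ℤtoℚ z) ℚᵘ.≃ mkℚᵘ z 0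
  toℚᵘ-ℤtoℚ z = ℚP.toℚᵘ-fromℚᵘ (mkℚᵘ z 0)
  i*1+j*1≡i+j : i ℤ.* ℤ.1ℤ ℤ.+ j ℤ.* ℤ.1ℤ ≡ i ℤ.+ j
  i*1+j*1≡i+j = cong₂ ℤ._+_ (ℤP.*-identityʳ i) (ℤP.*-identityʳ j)

open ≡-Reasoning

ℕtoℚ-homo-+ : ∀ m n → ℕtoℚ (m ℕ.+ n) ≡ ℕtoℚ m + ℕtoℚ n
ℕtoℚ-homo-+ m n = ℤtoℚ-homo-+ (+ m) (+ n)

ℕtoℚ-homo-* : ∀ m n → ℕtoℚ (m ℕ.* n) ≡ ℕtoℚ m * ℕtoℚ n
ℕtoℚ-homo-* zero    n = sym (ℚP.*-zeroˡ (ℕtoℚ n))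
ℕtoℚ-homo-* (suc m) n = begin
  ℕtoℚ (n ℕ.+ m ℕ.* n)             ≡⟨ ℕtoℚ-homo-+ n (m ℕ.* n) ⟩
  ℕtoℚ n + ℕtoℚ (m ℕ.* n)          ≡⟨ cong (λ q → ℕtoℚ n + q) (ℕtoℚ-homo-* m n) ⟩
  ℕtoℚ n + ℕtoℚ m * ℕtoℚ n         ≡⟨ cong (_+ ℕtoℚ m * ℕtoℚ n) (ℚP.*-identityˡ (ℕtoℚ n)) ⟨
  1ℚ * ℕtoℚ n + ℕtoℚ m * ℕtoℚ n    ≡⟨ ℚP.*-distribʳ-+ (ℕtoℚ n) 1ℚ (ℕtoℚ m) ⟨
  (1ℚ + ℕtoℚ m) * ℕtoℚ n           ≡⟨ cong (_* ℕtoℚ n) (ℕtoℚ-homo-+ 1 m) ⟨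
  ℕtoℚ (suc m) * ℕtoℚ n            ∎

pow2inv-inverseˡ : ∀ n → pow2inv n * ℕtoℚ (2 ℕ.^ n) ≡ 1ℚ
pow2inv-inverseˡ zero    = refl
pow2inv-inverseˡ (suc n) = begin
  ½ * P * ℕtoℚ (2 ℕ.* 2 ℕ.^ n)  ≡⟨ cong (½ * P *_) (ℕtoℚ-homo-* 2 (2 ℕ.^ n)) ⟩
  ½ * P * (ℕtoℚ 2 * C)          ≡⟨ solve 2 (λ P C → con ½ :* P :* (con (ℕtoℚ 2) :* C) := P :* C) refl P C ⟩
  P * C                         ≡⟨ pow2inv-inverseˡ n ⟩
  1ℚ                            ∎
  where
  open +-*-Solver
  P = pow2inv n
  C = ℕtoℚ (2 ℕ.^ n)

fibℚ : ℕ → ℚ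
fibℚ n = ℤtoℚ (fibℕ n)

fibℚ-suc-suc : ∀ n → fibℚ (suc (suc n)) ≡ fibℚ (suc n) + fibℚ n
fibℚ-suc-suc n = ℤtoℚ-homo-+ (fibℕ (suc n)) (fibℕ n)

fib-⊖-2 : ∀ k → ℤtoℚ (fib (k ⊖ 2)) ≡ ℕtoℚ 2 * fibℚ k - fibℚ (suc k)
fib-⊖-2 zero          = refl
fib-⊖-2 (suc zero)    = refl
fib-⊖-2 (suc (suc k)) = begin
  F₀
    ≡⟨ solve 2 (λ F₀ F₁ → F₀ := con (ℕtoℚ 2) :* (F₁ :+ F₀) :- (F₁ :+ F₀ :+ F₁)) refl F₀ F₁ ⟩
  ℕtoℚ 2 * (F₁ + F₀) - (F₁ + F₀ + F₁)
    ≡⟨ cong (λ F₂ → ℕtoℚ 2 * F₂ - (F₂ + F₁)) (fibℚ-suc-suc k) ⟨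
  ℕtoℚ 2 * F₂ - (F₂ + F₁)
    ≡⟨ cong (ℕtoℚ 2 * F₂ -_) (fibℚ-suc-suc (suc k)) ⟨
  ℕtoℚ 2 * F₂ - fibℚ (3 ℕ.+ k)
    ∎
  where
  open +-*-Solver
  F₀ = fibℚ k
  F₁ = fibℚ (suc k)
  F₂ = fibℚ (2 ℕ.+ k)

reducedB : ℕ → ℕ → ℚ
reducedB s n = ℕtoℚ s * fibℚ n + ℕtoℚ 2 * fibℚ (suc n)

module _ (s : ℕ) where
  open +-*-Solver
  private
    C = ℕtoℚ (2 ℕ.^ s)
    S = ℕtoℚ (suc s)

  bseq≡2^s*reducedB : ∀ n → ℤtoℚ (bseq (suc s) n) ≡ ℕtoℚ (2 ℕ.^ s) * reducedB (suc s) n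
  bseq≡2^s*reducedB zero = begin
    ℕtoℚ (2 ℕ.* 2 ℕ.^ s)
      ≡⟨ ℕtoℚ-homo-* 2 (2 ℕ.^ s) ⟩
    ℕtoℚ 2 * C
      ≡⟨ solve 2 (λ C S → con (ℕtoℚ 2) :* C
                          := C :* (S :* con (fibℚ 0) :+ con (ℕtoℚ 2) :* con (fibℚ 1))) refl C S ⟩
    C * reducedB (suc s) 0
      ∎
  bseq≡2^s*reducedB (suc zero) = begin
    ℕtoℚ (2 ℕ.^ s ℕ.* (suc s ℕ.+ 2))
      ≡⟨ ℕtoℚ-homo-* (2 ℕ.^ s) (suc s ℕ.+ 2) ⟩
    C * ℕtoℚ (suc s ℕ.+ 2)
      ≡⟨ cong (C *_) (ℕtoℚ-homo-+ (suc s) 2) ⟩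
    C * (S + ℕtoℚ 2)
      ≡⟨ solve 2 (λ C S → C :* (S :+ con (ℕtoℚ 2))
                          := C :* (S :* con (fibℚ 1) :+ con (ℕtoℚ 2) :* con (fibℚ 2))) refl C S ⟩
    C * reducedB (suc s) 1
      ∎
  bseq≡2^s*reducedB (suc (suc n)) = begin
    ℤtoℚ (bseq (suc s) (suc n) ℤ.+ bseq (suc s) n)
      ≡⟨ ℤtoℚ-homo-+ (bseq (suc s) (suc n)) (bseq (suc s) n) ⟩
    ℤtoℚ (bseq (suc s) (suc n)) + ℤtoℚ (bseq (suc s) n)
      ≡⟨ cong₂ _+_ (bseq≡2^s*reducedB (suc n)) (bseq≡2^s*reducedB n) ⟩
    C * (S * F₁ + ℕtoℚ 2 * F₂) + C * (S * F₀ + ℕtoℚ 2 * F₁)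
      ≡⟨ solve 5 (λ C S F₀ F₁ F₂ →
                    C :* (S :* F₁ :+ con (ℕtoℚ 2) :* F₂) :+ C :* (S :* F₀ :+ con (ℕtoℚ 2) :* F₁)
                    := C :* (S :* (F₁ :+ F₀) :+ con (ℕtoℚ 2) :* (F₂ :+ F₁))) refl C S F₀ F₁ F₂ ⟩
    C * (S * (F₁ + F₀) + ℕtoℚ 2 * (F₂ + F₁))
      ≡⟨ cong₂ (λ F₂ F₃ → C * (S * F₂ + ℕtoℚ 2 * F₃)) (fibℚ-suc-suc n) (fibℚ-suc-suc (suc n)) ⟨
    C * reducedB (suc s) (suc (suc n)) ∎
    where
    F₀ = fibℚ n
    F₁ = fibℚ (suc n)
    F₂ = fibℚ (2 ℕ.+ n)

2p-≡⊖ : ∀ p {k} c d → 2 ℕ.* p ≡ c ℕ.+ k → 2p- p (c ℕ.+ d) ≡ k ⊖ d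
2p-≡⊖ p {k} c d 2p≡c+k = begin
  + (2 ℕ.* p) ℤ.- + (c ℕ.+ d)  ≡⟨ ℤP.m-n≡m⊖n (2 ℕ.* p) (c ℕ.+ d) ⟩
  (2 ℕ.* p) ⊖ (c ℕ.+ d)        ≡⟨ cong (_⊖ (c ℕ.+ d)) 2p≡c+k ⟩
  (c ℕ.+ k) ⊖ (c ℕ.+ d)        ≡⟨ ℤP.+-cancelˡ-⊖ c k d ⟩
  k ⊖ d                        ∎

b-+ : ∀ s n → b s (+ n) ≡ bseq s (2 ℕ.+ n)
b-+ s n = cong (bseq s) (ℕP.+-comm n 2)

x-via-fib : ∀ s₁ s₂ p {k} → 2 ℕ.* p ≡ 4 ℕ.+ k → x s₁ s₂ p ≡
  (ℕtoℚ 2 * ℕtoℚ s₁ + ℕtoℚ 2 * ℕtoℚ s₂ + ½ * ℕtoℚ s₁ * ℕtoℚ s₂ + ℕtoℚ 8) * fibℚ (2 ℕ.+ k)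
  - (ℕtoℚ s₁ + ℕtoℚ s₂ + ℕtoℚ 8) * fibℚ k
  + ℕtoℚ 2 * (ℕtoℚ 2 * fibℚ k - fibℚ (suc k))
x-via-fib s₁ s₂ p {k} 2p≡4+k = begin
  x s₁ s₂ p
    ≡⟨ cong₂ (λ f₂ f₄ → A * ℤtoℚ f₂ - B * ℤtoℚ f₄ + ℕtoℚ 2 * ℤtoℚ (fib (2p- p 6)))
             (cong fib (2p-≡⊖ p 2 0 2p≡4+k)) (cong fib (2p-≡⊖ p 4 0 2p≡4+k)) ⟩
  A * fibℚ (2 ℕ.+ k) - B * fibℚ k + ℕtoℚ 2 * ℤtoℚ (fib (2p- p 6))
    ≡⟨ cong (λ F → A * fibℚ (2 ℕ.+ k) - B * fibℚ k + ℕtoℚ 2 * F)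
            (trans (cong (ℤtoℚ ∘ fib) (2p-≡⊖ p 4 2 2p≡4+k)) (fib-⊖-2 k)) ⟩
  A * fibℚ (2 ℕ.+ k) - B * fibℚ k + ℕtoℚ 2 * (ℕtoℚ 2 * fibℚ k - fibℚ (suc k)) ∎
  where
  A = ℕtoℚ 2 * ℕtoℚ s₁ + ℕtoℚ 2 * ℕtoℚ s₂ + ½ * ℕtoℚ s₁ * ℕtoℚ s₂ + ℕtoℚ 8
  B = ℕtoℚ s₁ + ℕtoℚ s₂ + ℕtoℚ 8

a-via-reducedB : ∀ s t p {k} → 2 ℕ.* p ≡ 4 ℕ.+ k →
  a (suc s) t p ≡ ℕtoℚ 2 * reducedB (suc s) (3 ℕ.+ k) + ℕtoℚ t * reducedB (suc s) (2 ℕ.+ k)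
a-via-reducedB s t p {k} 2p≡4+k = begin
  a (suc s) t p
    ≡⟨ cong₂ (λ u v → P * (ℕtoℚ 2 * ℤtoℚ (b (suc s) u) + T * ℤtoℚ (b (suc s) v)))
             (2p-≡⊖ p 3 0 2p≡4+k) (2p-≡⊖ p 4 0 2p≡4+k) ⟩
  P * (ℕtoℚ 2 * ℤtoℚ (b (suc s) (+ (1 ℕ.+ k))) + T * ℤtoℚ (b (suc s) (+ k)))
    ≡⟨ cong₂ (λ u v → P * (ℕtoℚ 2 * ℤtoℚ u + T * ℤtoℚ v)) (b-+ (suc s) (1 ℕ.+ k)) (b-+ (suc s) k) ⟩
  P * (ℕtoℚ 2 * ℤtoℚ (bseq (suc s) (3 ℕ.+ k)) + T * ℤtoℚ (bseq (suc s) (2 ℕ.+ k)))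
    ≡⟨ cong₂ (λ u v → P * (ℕtoℚ 2 * u + T * v))
             (bseq≡2^s*reducedB s (3 ℕ.+ k)) (bseq≡2^s*reducedB s (2 ℕ.+ k)) ⟩
  P * (ℕtoℚ 2 * (C * B₃) + T * (C * B₂))
    ≡⟨ solve 5 (λ P C T B₃ B₂ → P :* (con (ℕtoℚ 2) :* (C :* B₃) :+ T :* (C :* B₂))
                              := P :* C :* (con (ℕtoℚ 2) :* B₃ :+ T :* B₂)) refl P C T B₃ B₂ ⟩
  P * C * (ℕtoℚ 2 * B₃ + T * B₂)
    ≡⟨ cong (_* (ℕtoℚ 2 * B₃ + T * B₂)) (pow2inv-inverseˡ s) ⟩
  1ℚ * (ℕtoℚ 2 * B₃ + T * B₂)
    ≡⟨ ℚP.*-identityˡ (ℕtoℚ 2 * B₃ + T * B₂) ⟩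
  ℕtoℚ 2 * B₃ + T * B₂ ∎
  where
  open +-*-Solver
  P = pow2inv s
  C = ℕtoℚ (2 ℕ.^ s)
  T = ℕtoℚ t
  B₃ = reducedB (suc s) (3 ℕ.+ k)
  B₂ = reducedB (suc s) (2 ℕ.+ k)

fibonacci-identity : ∀ (S T F₀ F₁ F₂ F₃ F₄ : ℚ) →
  F₂ ≡ F₁ + F₀ → F₃ ≡ F₂ + F₁ → F₄ ≡ F₃ + F₂ →
  (ℕtoℚ 2 * S + ℕtoℚ 2 * T + ½ * S * T + ℕtoℚ 8) * F₂ - (S + T + ℕtoℚ 8) * F₀
    + ℕtoℚ 2 * (ℕtoℚ 2 * F₀ - F₁)
  ≡ (ℕtoℚ 2 * (S * F₃ + ℕtoℚ 2 * F₄) + T * (S * F₂ + ℕtoℚ 2 * F₃)) * ½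
fibonacci-identity S T F₀ F₁ _ _ _ refl refl refl = solve 4 (λ S T F₀ F₁ →
  let F₂ = F₁ :+ F₀
      F₃ = F₂ :+ F₁
      F₄ = F₃ :+ F₂
  in  (two :* S :+ two :* T :+ con ½ :* S :* T :+ con (ℕtoℚ 8)) :* F₂
        :- (S :+ T :+ con (ℕtoℚ 8)) :* F₀ :+ two :* (two :* F₀ :- F₁)
      := (two :* (S :* F₃ :+ two :* F₄) :+ T :* (S :* F₂ :+ two :* F₃)) :* con ½)
  refl S T F₀ F₁
  where
  open +-*-Solver
  two : ∀ {n} → Polynomial n
  two = con (ℕtoℚ 2)

lemma4p2 : (p s₁ s₂ : ℕ) → 2 ≤ p → 1 ≤ s₁ → 1 ≤ s₂ → x s₁ s₂ p ≡ a s₁ s₂ p * ½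
lemma4p2 (suc zero) _ _ (s≤s ()) _ _
lemma4p2 (suc (suc q)) (suc s) t _ _ _ = begin
  x (suc s) t p
    ≡⟨ x-via-fib (suc s) t p 2p≡4+k ⟩
  (ℕtoℚ 2 * S + ℕtoℚ 2 * T + ½ * S * T + ℕtoℚ 8) * F 2 - (S + T + ℕtoℚ 8) * F 0
    + ℕtoℚ 2 * (ℕtoℚ 2 * F 0 - F 1)
    ≡⟨ fibonacci-identity S T (F 0) (F 1) (F 2) (F 3) (F 4) (F≡ 0) (F≡ 1) (F≡ 2) ⟩
  (ℕtoℚ 2 * reducedB (suc s) (3 ℕ.+ k) + T * reducedB (suc s) (2 ℕ.+ k)) * ½
    ≡⟨ cong (_* ½) (a-via-reducedB s t p 2p≡4+k) ⟨
  a (suc s) t p * ½ ∎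
  where
  p = suc (suc q)
  k = 2 ℕ.* q
  2p≡4+k : 2 ℕ.* p ≡ 4 ℕ.+ k
  2p≡4+k = ℕP.*-distribˡ-+ 2 2 q
  S = ℕtoℚ (suc s)
  T = ℕtoℚ t
  F : ℕ → ℚ
  F i = fibℚ (i ℕ.+ k)
  F≡ : ∀ i → F (2 ℕ.+ i) ≡ F (1 ℕ.+ i) + F i
  F≡ i = fibℚ-suc-suc (i ℕ.+ k)
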